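{- Let $q$ be a prime power, $N\ge3$, $X$ an $N$-dimensional $\mathbb{F}_q$-space, and $P \subseteq \mathcal{G}_q(X,1)$ a point set with $\dim\langle P\rangle=N$; let $\ell=|P|$ and let $C_P$ be a block code associated to $P$. Then $$\delta_q(X,N-1,P) = \frac{W_\ell(C_P)}{q^N-1}.$$
   Context: $\mathcal{G}_q(X,j)$ is the set of $j$-dimensional subspaces of $X$; a point set is a nonempty $P\subseteq\mathcal{G}_q(X,1)$, $\langle P\rangle=\sum_{L\in P}L$; $V\le X$ distinguishes $P$ if no element of $P$ lies in $V$; $\delta_q(X,k,P)$ is the number of $V\in\mathcal{G}_q(X,k)$ distinguishing $P$ divided by $|\mathcal{G}_q(X,k)|$. A block code associated to $P=\{P_1,\dots,P_\ell\}$ is obtained by fixing an isomorphism $X\cong\mathbb{F}_q^N$, choosing nonzero vectors $p_i$ spanning $P_i$, forming the $N\times\ell$ matrix $G$ with columns $p_1,\dots,p_\ell$, and taking $C_P$ to be the row space of $G$ (an $N$-dimensional subspace of $\mathbb{F}_q^\ell$). For a subspace $C\le\mathbb{F}_q^\ell$, $W_j(C)$ is the number of vectors in $C$ with exactly $j$ nonzero coordinates. -}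

module Defs where

open import Level using (Level; _⊔_; suc)
open import Algebra.Bundles using (CommutativeRing)
open import Data.Nat as ℕ using (ℕ; zero; _∸_)
open import Data.Fin using (Fin)
import Data.Fin as F
open import Data.Product using (Σ; ∃; _×_; _,_; proj₁)
open import Relation.Nullary using (¬_)
open import Relation.Binary.Bundles using (Setoid)
import Relation.Binary.PropositionalEquality as ≡
open import Function.Bundles using (Bijection)

record Field (c ℓ : Level) : Set (suc (c ⊔ ℓ)) where
  field
    commutativeRing : CommutativeRing c ℓ
  open CommutativeRing commutativeRing public
  field
    0≉1     : ¬ (0# ≈ 1#)
    inverse : ∀ x → ¬ (x ≈ 0#) → ∃ λ y → (x * y) ≈ 1#

HasCard : ∀ {a ℓ} → ℕ → Setoid a ℓ → Set (a ⊔ ℓ)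
HasCard n S = Bijection (≡.setoid (Fin n)) S

SubSetoid : ∀ {a ℓ p} (S : Setoid a ℓ) → (Setoid.Carrier S → Set p) → Setoid (a ⊔ p) ℓ
SubSetoid S P = record
  { Carrier       = Σ (Setoid.Carrier S) P
  ; _≈_           = λ x y → Setoid._≈_ S (proj₁ x) (proj₁ y)
  ; isEquivalence = record
    { refl  = Setoid.refl S
    ; sym   = Setoid.sym S
    ; trans = Setoid.trans S
    }
  }

module FieldDefs {c ℓ} (𝔽 : Field c ℓ) where
  open Field 𝔽

  sumF : ∀ {n} → (Fin n → Carrier) → Carrier
  sumF {zero}    f = 0#
  sumF {ℕ.suc n} f = f F.zero + sumF (λ i → f (F.suc i))

  Vect : ℕ → Set c
  Vect n = Fin n → Carrier

  _≈ᵥ_ : ∀ {n} → Vect n → Vect n → Set ℓ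
  u ≈ᵥ v = ∀ i → u i ≈ v i

  0ᵥ : ∀ {n} → Vect n
  0ᵥ _ = 0#

  lincomb : ∀ {n k} → (Fin k → Carrier) → (Fin k → Vect n) → Vect n
  lincomb a b r = sumF (λ i → a i * b i r)

  _∈Span_ : ∀ {n k} → Vect n → (Fin k → Vect n) → Set (c ⊔ ℓ)
  v ∈Span b = ∃ λ a → v ≈ᵥ lincomb a b

  LinIndep : ∀ {n k} → (Fin k → Vect n) → Set (c ⊔ ℓ)
  LinIndep b = ∀ a → lincomb a b ≈ᵥ 0ᵥ → ∀ i → a i ≈ 0#

  Basis : ℕ → ℕ → Set (c ⊔ ℓ)
  Basis n k = Σ (Fin k → Vect n) LinIndep

  -- 𝒢_q(𝔽^n, k): k-dimensional subspaces; two bases are identified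
  -- iff they span the same subspace
  Grass : ℕ → ℕ → Setoid (c ⊔ ℓ) (c ⊔ ℓ)
  Grass n k = record
    { Carrier       = Basis n k
    ; _≈_           = λ B B′ → ∀ v → (v ∈Span proj₁ B → v ∈Span proj₁ B′)
                                   × (v ∈Span proj₁ B′ → v ∈Span proj₁ B)
    ; isEquivalence = record
      { refl  = λ v → (λ x → x) , (λ x → x)
      ; sym   = λ e v → Data.Product.proj₂ (e v) , proj₁ (e v)
      ; trans = λ e f v → (λ x → proj₁ (f v) (proj₁ (e v) x))
                        , (λ x → Data.Product.proj₂ (e v) (Data.Product.proj₂ (f v) x))
      }
    }

  -- A point set in 𝔽^n given by chosen spanning vectors p₁,…,p_L of
  -- L distinct 1-dimensional subspaces.
  IsPointFamily : ∀ {n L} → (Fin L → Vect n) → Set (c ⊔ ℓ)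
  IsPointFamily {n} {L} p =
      (∀ i → ¬ (p i ≈ᵥ 0ᵥ))
    × (∀ i j → ¬ (i ≡.≡ j) → ¬ (p i ∈Span (λ (_ : Fin 1) → p j)))

  -- ⟨P⟩ = 𝔽^n, i.e. dim ⟨P⟩ = n
  SpansAll : ∀ {n L} → (Fin L → Vect n) → Set (c ⊔ ℓ)
  SpansAll {n} p = ∀ (v : Vect n) → v ∈Span p

  -- V distinguishes P: no point of P lies in V (P_i ⊆ V iff p_i ∈ V)
  Distinguishes : ∀ {n k L} → Basis n k → (Fin L → Vect n) → Set (c ⊔ ℓ)
  Distinguishes B p = ∀ i → ¬ (p i ∈Span proj₁ B)

  DistGrass : ∀ {n L} → ℕ → (Fin L → Vect n) → Setoid (c ⊔ ℓ) (c ⊔ ℓ)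
  DistGrass {n} k p = SubSetoid (Grass n k) (λ B → Distinguishes B p)

  -- generator matrix G (n × L) with columns p_i, given by its rows
  genRows : ∀ {n L} → (Fin L → Vect n) → Fin n → Vect L
  genRows p r i = p i r

  -- membership in the row space of G, i.e. in the code C_P
  InCode : ∀ {n L} → (Fin L → Vect n) → Vect L → Set (c ⊔ ℓ)
  InCode p w = w ∈Span genRows p

  VectSetoid : ℕ → Setoid c ℓ
  VectSetoid L = record
    { Carrier       = Vect L
    ; _≈_           = _≈ᵥ_
    ; isEquivalence = record
      { refl  = λ i → refl
      ; sym   = λ e i → sym (e i)
      ; trans = λ e f i → trans (e i) (f i)
      }
    }

  Support : ∀ {L} → Vect L → Setoid ℓ Level.zero
  Support {L} w = SubSetoid (≡.setoid (Fin L)) (λ i → ¬ (w i ≈ 0#))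

  HasWeight : ∀ {L} → Vect L → ℕ → Set ℓ
  HasWeight w j = HasCard j (Support w)

  -- { w ∈ C_P : wt(w) = j }, whose cardinality is W_j(C_P)
  CodeWords : ∀ {n L} → (Fin L → Vect n) → ℕ → Setoid (c ⊔ ℓ) ℓ
  CodeWords {n} {L} p j = SubSetoid (VectSetoid L) (λ w → InCode p w × HasWeight w j)

-- Count the functionals a on 𝔽^N with a(p_i) ≠ 0 for every point in two ways.  Since P
-- spans 𝔽^N, a ↦ (a(p_i))_i identifies them with the codewords of C_P of full weight ℓ,
-- so there are W_ℓ(C_P) of them.  On the other hand a ↦ ker a maps them onto the
-- hyperplanes distinguishing P, and the fibre over a hyperplane consists of the q − 1
-- nonzero multiples of one normal, so there are (q − 1)·D of them.  For the empty point
-- set the same count reads q^N − 1 = (q − 1)·H, and the identity follows.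
module Submission where

open import Defs
open import Level using (Level; _⊔_)
open import Data.Nat as ℕ using (ℕ; zero; suc; _<_; _≤_; s≤s; _^_)
import Data.Nat.Properties as ℕₚ
open import Data.Fin using (Fin; zero; suc; punchIn; punchOut)
import Data.Fin.Properties as Fin
open import Data.Vec.Functional using (_∷_; tail; insertAt)
open import Data.Vec.Functional.Properties using (insertAt-lookup; insertAt-punchIn)
open import Data.Product using (∃; _×_; _,_; proj₁; proj₂)
open import Data.Product.Relation.Binary.Pointwise.NonDependent using (_×ₛ_; Pointwise-≡↔≡)
open import Data.Product.Function.NonDependent.Setoid using (_×-bijection_)
open import Function using (_∘_)
open import Function.Bundles using (Bijection)
open import Function.Definitions using (Congruent; Injective; StrictlySurjective)
open import Function.Consequences using (strictlySurjective⇒surjective)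
open import Function.Properties.Inverse using (Inverse⇒Bijection)
open import Function.Properties.Bijection using (Bijection⇒Inverse)
import Function.Construct.Composition as Comp
import Function.Construct.Identity as Id
import Function.Construct.Symmetry as Sym
open import Relation.Nullary using (¬_; Dec; yes; no)
open import Relation.Nullary.Decidable using (map′)
open import Relation.Nullary.Negation using (contradiction)
open import Relation.Binary.Bundles using (Setoid)
open import Relation.Binary.Definitions using (Decidable)
import Relation.Binary.PropositionalEquality as ≡
open ≡ using (_≡_; _≢_)

-- Cardinalities of finite setoids

module _ {a ℓ₁ b ℓ₂} {S : Setoid a ℓ₁} {T : Setoid b ℓ₂} where
  open Setoid S using () renaming (Carrier to A; _≈_ to _≈₁_)
  open Setoid T using () renaming (Carrier to B; _≈_ to _≈₂_; trans to trans₂)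

  mkBijection : (f : A → B) → Congruent _≈₁_ _≈₂_ f → Injective _≈₁_ _≈₂_ f →
                StrictlySurjective _≈₂_ f → Bijection S T
  mkBijection f f-cong f-inj f-surj = record
    { to        = f
    ; cong      = f-cong
    ; bijective = f-inj , strictlySurjective⇒surjective trans₂ f-cong f-surj
    }

  bijection-sym : Bijection S T → Bijection T S
  bijection-sym f = Inverse⇒Bijection (Sym.inverse (Bijection⇒Inverse f))

module _ {a ℓ} {S : Setoid a ℓ} where
  open Setoid S

  HasCard-≤ : ∀ {m n} → HasCard m S → HasCard n S → m ≤ n
  HasCard-≤ f g = Fin.injective⇒≤ (Bijection.injective (Comp.bijection f (bijection-sym g)))

  HasCard-unique : ∀ {m n} → HasCard m S → HasCard n S → m ≡ n
  HasCard-unique f g = ℕₚ.≤-antisym (HasCard-≤ f g) (HasCard-≤ g f)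

  HasCard⇒decidable : ∀ {n} → HasCard n S → Decidable _≈_
  HasCard⇒decidable f x y = map′ injective cong (to x Fin.≟ to y)
    where open Bijection (bijection-sym f)

  HasCard-remove : ∀ {n} → HasCard n S → (z : Carrier) →
                   HasCard (n ℕ.∸ 1) (SubSetoid S (λ x → ¬ x ≈ z))
  HasCard-remove {zero}  f z = contradiction (proj₁ (Bijection.strictlySurjective f z)) λ ()
  HasCard-remove {suc n} f z = mkBijection (λ j → to (punchIn i j) , to-punchIn≉z j) (λ { ≡.refl → refl })
                                           (λ e → Fin.punchIn-injective i _ _ (injective e)) surjective′
    where
    open Bijection f
    index : Carrier → Fin (suc n)
    index x = proj₁ (strictlySurjective x)
    to-index : ∀ x → to (index x) ≈ x
    to-index x = proj₂ (strictlySurjective x)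
    i : Fin (suc n)
    i = index z
    to-punchIn≉z : ∀ j → ¬ to (punchIn i j) ≈ z
    to-punchIn≉z j e = Fin.punchInᵢ≢i i j (injective (trans e (sym (to-index z))))
    surjective′ : ∀ y → ∃ λ j → to (punchIn i j) ≈ proj₁ y
    surjective′ (x , x≉z) =
      punchOut i≢x , trans (reflexive (≡.cong to (Fin.punchIn-punchOut i≢x))) (to-index x)
      where
      i≢x : i ≢ index x
      i≢x i≡x = x≉z (trans (sym (to-index x)) (trans (reflexive (≡.cong to (≡.sym i≡x))) (to-index z)))

module _ {a ℓ₁ b ℓ₂} {S : Setoid a ℓ₁} {T : Setoid b ℓ₂} where

  HasCard-× : ∀ {m n} → HasCard m S → HasCard n T → HasCard (m ℕ.* n) (S ×ₛ T)
  HasCard-× {m} {n} f g = Comp.bijection (Inverse⇒Bijection (Fin.*↔× {m} {n}))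
    (Comp.bijection (bijection-sym (Inverse⇒Bijection Pointwise-≡↔≡)) (f ×-bijection g))

injective⇒surjective : ∀ {n} (f : Fin n → Fin n) → (∀ {x y} → f x ≡ f y → x ≡ y) →
                       ∀ i → ∃ λ j → f j ≡ i
injective⇒surjective {suc n} f f-inj i with Fin.any? (λ j → f j Fin.≟ i)
... | yes hit = hit
... | no miss = contradiction (Fin.injective⇒≤ punchOut-inj) ℕₚ.1+n≰n
  where
  i≢f : ∀ j → i ≢ f j
  i≢f j i≡fj = miss (j , ≡.sym i≡fj)
  punchOut-inj : ∀ {x y} → punchOut (i≢f x) ≡ punchOut (i≢f y) → x ≡ y
  punchOut-inj e = f-inj (Fin.punchOut-injective (i≢f _) (i≢f _) e)

punchIn-elim : ∀ {p n} (P : Fin (suc n) → Set p) r → P r → (∀ j → P (punchIn r j)) → ∀ t → P t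
punchIn-elim P r Pr P-punchIn t with r Fin.≟ t
... | yes ≡.refl = Pr
... | no r≢t     = ≡.subst P (Fin.punchIn-punchOut r≢t) (P-punchIn (punchOut r≢t))

module _ {p n} {P : Fin n → Set p} where

  HasCard-all : (∀ i → P i) → HasCard n (SubSetoid (≡.setoid (Fin n)) P)
  HasCard-all all = mkBijection (λ i → i , all i) (λ e → e) (λ e → e) (λ (i , _) → i , ≡.refl)

  HasCard-full : HasCard n (SubSetoid (≡.setoid (Fin n)) P) → ∀ i → P i
  HasCard-full f i with injective⇒surjective (λ j → proj₁ (Bijection.to f j)) (Bijection.injective f) i
  ... | j , ≡.refl = proj₂ (Bijection.to f j)

module LinearAlgebra {ℓ₁ ℓ₂} (𝔽 : Field ℓ₁ ℓ₂) (_≟_ : Decidable (Field._≈_ 𝔽)) where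

  open Field 𝔽 hiding (zero)
  open FieldDefs 𝔽
  open import Algebra.Properties.Ring ring
    using (-‿distribˡ-*; -‿distribʳ-*; -‿involutive; +-inverseˡ-unique)
  open import Algebra.Properties.Semiring.Sum semiring
    using (sum; sum-cong-≋; sum-cong-≗; sum-replicate-zero; sum-remove; ∑-comm; ∑-distrib-+;
           *-distribˡ-sum; *-distribʳ-sum)
  open import Algebra.Properties.CommutativeSemigroup *-commutativeSemigroup using (x∙yz≈y∙xz; xy∙z≈zy∙x)
  open import Relation.Binary.Reasoning.Setoid setoid

  inv : ∀ x → ¬ x ≈ 0# → Carrier
  inv x x≉0 = proj₁ (inverse x x≉0)

  inv-inverseˡ : ∀ {x} (x≉0 : ¬ x ≈ 0#) → inv x x≉0 * x ≈ 1#
  inv-inverseˡ {x} x≉0 = trans (*-comm _ x) (proj₂ (inverse x x≉0))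

  *-cancelʳ : ∀ {x x′ y} → ¬ y ≈ 0# → x * y ≈ x′ * y → x ≈ x′
  *-cancelʳ {x} {x′} {y} y≉0 xy≈x′y = begin
    x                       ≈⟨ scale x ⟨
    x * y * inv y y≉0       ≈⟨ *-congʳ xy≈x′y ⟩
    x′ * y * inv y y≉0      ≈⟨ scale x′ ⟩
    x′                      ∎
    where
    scale : ∀ z → z * y * inv y y≉0 ≈ z
    scale z = trans (*-assoc z y _) (trans (*-congˡ (proj₂ (inverse y y≉0))) (*-identityʳ z))

  x*y≈0⇒x≈0 : ∀ {x y} → ¬ y ≈ 0# → x * y ≈ 0# → x ≈ 0#
  x*y≈0⇒x≈0 {x} {y} y≉0 xy≈0 = *-cancelʳ y≉0 (trans xy≈0 (sym (zeroˡ y)))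

  x*y≈0⇒y≈0 : ∀ {x y} → ¬ x ≈ 0# → x * y ≈ 0# → y ≈ 0#
  x*y≈0⇒y≈0 {x} {y} x≉0 xy≈0 = x*y≈0⇒x≈0 x≉0 (trans (*-comm y x) xy≈0)

  x≈0⇒x*y+z≈z : ∀ {x} y z → x ≈ 0# → x * y + z ≈ z
  x≈0⇒x*y+z≈z y z x≈0 = trans (+-congʳ (trans (*-congʳ x≈0) (zeroˡ y))) (+-identityˡ z)

  x-x*y⁻¹*y≈0 : ∀ x {y} (y≉0 : ¬ y ≈ 0#) → x + - (x * inv y y≉0) * y ≈ 0#
  x-x*y⁻¹*y≈0 x {y} y≉0 = begin
    x + - (x * y⁻¹) * y     ≈⟨ +-congˡ (sym (-‿distribˡ-* _ y)) ⟩
    x + - (x * y⁻¹ * y)     ≈⟨ +-congˡ (-‿cong (trans (*-assoc x _ y) (*-congˡ (inv-inverseˡ y≉0)))) ⟩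
    x + - (x * 1#)          ≈⟨ +-congˡ (-‿cong (*-identityʳ x)) ⟩
    x + - x                 ≈⟨ -‿inverseʳ x ⟩
    0#                      ∎
    where y⁻¹ = inv y y≉0

  sumF≡sum : ∀ {n} (f : Fin n → Carrier) → sumF f ≡ sum f
  sumF≡sum {zero}  f = ≡.refl
  sumF≡sum {suc n} f = ≡.cong (f zero +_) (sumF≡sum (f ∘ suc))

  sumF-cong : ∀ {n} {f g : Fin n → Carrier} → (∀ i → f i ≈ g i) → sumF f ≈ sumF g
  sumF-cong {f = f} {g} f≈g rewrite sumF≡sum f | sumF≡sum g = sum-cong-≋ f≈g

  sumF-zero : ∀ {n} {f : Fin n → Carrier} → (∀ i → f i ≈ 0#) → sumF f ≈ 0#
  sumF-zero {n} f≈0 =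
    trans (sumF-cong f≈0) (trans (reflexive (sumF≡sum {n} (λ _ → 0#))) (sum-replicate-zero n))

  sumF-+ : ∀ {n} (f g : Fin n → Carrier) → sumF (λ i → f i + g i) ≈ sumF f + sumF g
  sumF-+ f g rewrite sumF≡sum f | sumF≡sum g | sumF≡sum (λ i → f i + g i) = ∑-distrib-+ f g

  *-distribˡ-sumF : ∀ {n} x (f : Fin n → Carrier) → x * sumF f ≈ sumF (λ i → x * f i)
  *-distribˡ-sumF x f rewrite sumF≡sum f | sumF≡sum (λ i → x * f i) = *-distribˡ-sum x f

  *-distribʳ-sumF : ∀ {n} x (f : Fin n → Carrier) → sumF f * x ≈ sumF (λ i → f i * x)
  *-distribʳ-sumF x f rewrite sumF≡sum f | sumF≡sum (λ i → f i * x) = *-distribʳ-sum x f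

  sumF-remove : ∀ {n} (f : Fin (suc n) → Carrier) k → sumF f ≈ f k + sumF (f ∘ punchIn k)
  sumF-remove f k rewrite sumF≡sum f | sumF≡sum (f ∘ punchIn k) = sum-remove f

  sumF-comm : ∀ {m n} (f : Fin m → Fin n → Carrier) →
              sumF (λ i → sumF (f i)) ≈ sumF (λ j → sumF (λ i → f i j))
  sumF-comm f = begin
    sumF (λ i → sumF (f i))
      ≡⟨ ≡.trans (sumF≡sum (λ i → sumF (f i))) (sum-cong-≗ (sumF≡sum ∘ f)) ⟩
    sum (λ i → sum (f i))
      ≈⟨ ∑-comm f ⟩
    sum (λ j → sum (λ i → f i j))
      ≡⟨ ≡.trans (sumF≡sum (λ j → sumF (λ i → f i j)))
                 (sum-cong-≗ (λ j → sumF≡sum (λ i → f i j))) ⟨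
    sumF (λ j → sumF (λ i → f i j))
      ∎

  -- Dot products

  unit : ∀ {n} → Fin n → Vect n
  unit zero    zero    = 1#
  unit zero    (suc _) = 0#
  unit (suc _) zero    = 0#
  unit (suc s) (suc t) = unit s t

  unit-sym : ∀ {n} (s t : Fin n) → unit s t ≡ unit t s
  unit-sym zero    zero    = ≡.refl
  unit-sym zero    (suc _) = ≡.refl
  unit-sym (suc _) zero    = ≡.refl
  unit-sym (suc s) (suc t) = unit-sym s t

  unit-≢ : ∀ {n} {s t : Fin n} → s ≢ t → unit s t ≡ 0#
  unit-≢ {s = zero}  {zero}  s≢t = contradiction ≡.refl s≢t
  unit-≢ {s = zero}  {suc _} _   = ≡.refl
  unit-≢ {s = suc _} {zero}  _   = ≡.refl
  unit-≢ {s = suc _} {suc _} s≢t = unit-≢ (s≢t ∘ ≡.cong suc)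

  unit-punchIn : ∀ {n} r (s t : Fin n) → unit (punchIn r s) (punchIn r t) ≡ unit s t
  unit-punchIn zero    s       t       = ≡.refl
  unit-punchIn (suc r) zero    zero    = ≡.refl
  unit-punchIn (suc r) zero    (suc t) = ≡.refl
  unit-punchIn (suc r) (suc s) zero    = ≡.refl
  unit-punchIn (suc r) (suc s) (suc t) = unit-punchIn r s t

  dot : ∀ {n} → Vect n → Vect n → Carrier
  dot a v = sumF (λ t → a t * v t)

  dot-cong : ∀ {n} {a a′ v v′ : Vect n} → a ≈ᵥ a′ → v ≈ᵥ v′ → dot a v ≈ dot a′ v′
  dot-cong a≈a′ v≈v′ = sumF-cong (λ t → *-cong (a≈a′ t) (v≈v′ t))

  dot-zeroˡ : ∀ {n} (v : Vect n) → dot 0ᵥ v ≈ 0#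
  dot-zeroˡ v = sumF-zero (λ t → zeroˡ (v t))

  dot-zeroʳ : ∀ {n} (a : Vect n) → dot a 0ᵥ ≈ 0#
  dot-zeroʳ a = sumF-zero (λ t → zeroʳ (a t))

  dot-scaleˡ : ∀ {n} x (a v : Vect n) → dot (λ t → x * a t) v ≈ x * dot a v
  dot-scaleˡ x a v =
    trans (sumF-cong (λ t → *-assoc x (a t) (v t))) (sym (*-distribˡ-sumF x (λ t → a t * v t)))

  dot-+-scaleʳ : ∀ {n} (a u v : Vect n) x → dot a (λ t → u t + x * v t) ≈ dot a u + x * dot a v
  dot-+-scaleʳ a u v x = begin
    dot a (λ t → u t + x * v t)
      ≈⟨ sumF-cong (λ t → distribˡ (a t) (u t) (x * v t)) ⟩
    sumF (λ t → a t * u t + a t * (x * v t))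
      ≈⟨ sumF-+ (λ t → a t * u t) (λ t → a t * (x * v t)) ⟩
    dot a u + sumF (λ t → a t * (x * v t))
      ≈⟨ +-congˡ (sumF-cong (λ t → x∙yz≈y∙xz (a t) x (v t))) ⟩
    dot a u + sumF (λ t → x * (a t * v t))
      ≈⟨ +-congˡ (*-distribˡ-sumF x (λ t → a t * v t)) ⟨
    dot a u + x * dot a v
      ∎

  dot-unitʳ : ∀ {n} (a : Vect n) s → dot a (unit s) ≈ a s
  dot-unitʳ a zero    = trans (+-cong (*-identityʳ (a zero)) (dot-zeroʳ (tail a))) (+-identityʳ (a zero))
  dot-unitʳ a (suc s) = trans (+-cong (zeroʳ (a zero)) (dot-unitʳ (tail a) s)) (+-identityˡ (a (suc s)))

  dot-lincomb : ∀ {n k} (a : Vect n) (c : Fin k → Carrier) (b : Fin k → Vect n) →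
                dot a (lincomb c b) ≈ dot c (λ j → dot a (b j))
  dot-lincomb a c b = begin
    sumF (λ t → a t * sumF (λ j → c j * b j t))
      ≈⟨ sumF-cong (λ t → *-distribˡ-sumF (a t) (λ j → c j * b j t)) ⟩
    sumF (λ t → sumF (λ j → a t * (c j * b j t)))
      ≈⟨ sumF-comm (λ t j → a t * (c j * b j t)) ⟩
    sumF (λ j → sumF (λ t → a t * (c j * b j t)))
      ≈⟨ sumF-cong (λ j → sumF-cong (λ t → x∙yz≈y∙xz (a t) (c j) (b j t))) ⟩
    sumF (λ j → sumF (λ t → c j * (a t * b j t)))
      ≈⟨ sumF-cong (λ j → *-distribˡ-sumF (c j) (λ t → a t * b j t)) ⟨
    dot c (λ j → dot a (b j))
      ∎

  lincomb-unit : ∀ {n} (c : Vect n) → lincomb c unit ≈ᵥ c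
  lincomb-unit c t = trans (sumF-cong (λ s → *-congˡ (reflexive (unit-sym s t)))) (dot-unitʳ c t)

  -- Linear dependence and hyperplanes

  LinDep : ∀ {m n} → (Fin m → Vect n) → Set (ℓ₁ ⊔ ℓ₂)
  LinDep v = ∃ λ a → lincomb a v ≈ᵥ 0ᵥ × ∃ λ i → ¬ a i ≈ 0#

  linDep-tail : ∀ {m n} {v : Fin m → Vect (suc n)} →
                (∀ i → v i zero ≈ 0#) → LinDep (tail ∘ v) → LinDep v
  linDep-tail {v = v} v₀≈0 (a , a·v≈0 , i , aᵢ≉0) = a , a·v≈0′ , i , aᵢ≉0
    where
    a·v≈0′ : lincomb a v ≈ᵥ 0ᵥ
    a·v≈0′ zero    = sumF-zero (λ j → trans (*-congˡ (v₀≈0 j)) (zeroʳ (a j)))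
    a·v≈0′ (suc t) = a·v≈0 t

  lincomb-insertAt : ∀ {m n} (v : Fin (suc m) → Vect n) k (c b : Fin m → Carrier) →
                     lincomb (insertAt b k (dot b c)) v ≈ᵥ lincomb b (λ j t → v (punchIn k j) t + c j * v k t)
  lincomb-insertAt v k c b t = begin
    sumF (λ i → a i * v i t)
      ≈⟨ sumF-remove (λ i → a i * v i t) k ⟩
    a k * v k t + sumF (λ j → a (punchIn k j) * vⱼ j)
      ≈⟨ +-cong (*-congʳ (reflexive (insertAt-lookup b k _)))
                (sumF-cong (λ j → *-congʳ (reflexive (insertAt-punchIn b k _ j)))) ⟩
    dot b c * v k t + sumF (λ j → b j * vⱼ j)
      ≈⟨ +-comm _ _ ⟩
    sumF (λ j → b j * vⱼ j) + dot b c * v k t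
      ≈⟨ +-congˡ (*-distribʳ-sumF (v k t) (λ j → b j * c j)) ⟩
    sumF (λ j → b j * vⱼ j) + sumF (λ j → b j * c j * v k t)
      ≈⟨ sumF-+ (λ j → b j * vⱼ j) (λ j → b j * c j * v k t) ⟨
    sumF (λ j → b j * vⱼ j + b j * c j * v k t)
      ≈⟨ sumF-cong (λ j → +-congˡ (*-assoc (b j) (c j) (v k t))) ⟩
    sumF (λ j → b j * vⱼ j + b j * (c j * v k t))
      ≈⟨ sumF-cong (λ j → distribˡ (b j) (vⱼ j) (c j * v k t)) ⟨
    sumF (λ j → b j * (vⱼ j + c j * v k t))
      ∎
    where
    a = insertAt b k (dot b c)
    vⱼ = λ j → v (punchIn k j) t

  linDep-reduce : ∀ {m n} (v : Fin (suc m) → Vect n) k (c : Fin m → Carrier) →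
                  LinDep (λ j t → v (punchIn k j) t + c j * v k t) → LinDep v
  linDep-reduce v k c (b , b·w≈0 , i , bᵢ≉0) =
    insertAt b k (dot b c) , (λ t → trans (lincomb-insertAt v k c b t) (b·w≈0 t)) ,
    punchIn k i , bᵢ≉0 ∘ trans (reflexive (≡.sym (insertAt-punchIn b k _ i)))

  -- Gaussian elimination on the first coordinate: either it vanishes on the whole family,
  -- or a pivot vector clears it from all the others.
  linDep-of-dim< : ∀ {m n} → n < m → (v : Fin m → Vect n) → LinDep v
  linDep-of-dim< {suc m} {zero}  _         v = (λ _ → 1#) , (λ ()) , zero , 0≉1 ∘ sym
  linDep-of-dim< {suc m} {suc n} (s≤s n<m) v with Fin.all? (λ k → v k zero ≟ 0#)
  ... | yes row₀≈0 = linDep-tail {v = v} row₀≈0 (linDep-of-dim< (ℕₚ.m<n⇒m<1+n n<m) (tail ∘ v))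
  ... | no  row₀≉0 with Fin.¬∀⟶∃¬ _ _ (λ k → v k zero ≟ 0#) row₀≉0
  ...   | k , vₖ≉0 =
    linDep-reduce v k c (linDep-tail (λ j → x-x*y⁻¹*y≈0 (v (punchIn k j) zero) vₖ≉0)
                                     (linDep-of-dim< n<m _))
    where
    c : Fin m → Carrier
    c j = - (v (punchIn k j) zero * inv (v k zero) vₖ≉0)

  span⊆kernel : ∀ {n k} {a : Vect n} {B : Fin k → Vect n} →
                (∀ j → dot a (B j) ≈ 0#) → ∀ {v} → v ∈Span B → dot a v ≈ 0#
  span⊆kernel {a = a} {B} a⊥B {v} (c , v≈cB) = begin
    dot a v                      ≈⟨ dot-cong (λ _ → refl) v≈cB ⟩
    dot a (lincomb c B)          ≈⟨ dot-lincomb a c B ⟩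
    dot c (λ j → dot a (B j))    ≈⟨ dot-cong (λ _ → refl) a⊥B ⟩
    dot c 0ᵥ                     ≈⟨ dot-zeroʳ c ⟩
    0#                           ∎

  ∈Span-of-relation : ∀ {n k x} {v : Vect n} {c} {B : Fin k → Vect n} →
                      ¬ x ≈ 0# → (∀ t → x * v t + lincomb c B t ≈ 0#) → v ∈Span B
  ∈Span-of-relation {x = x} {v} {c} {B} x≉0 relation = (λ j → - x⁻¹ * c j) , v≈
    where
    x⁻¹ = inv x x≉0
    v≈ : ∀ t → v t ≈ lincomb (λ j → - x⁻¹ * c j) B t
    v≈ t = begin
      v t                                     ≈⟨ *-identityˡ (v t) ⟨
      1# * v t                                ≈⟨ *-congʳ (inv-inverseˡ x≉0) ⟨
      x⁻¹ * x * v t                           ≈⟨ *-assoc x⁻¹ x (v t) ⟩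
      x⁻¹ * (x * v t)                         ≈⟨ *-congˡ (+-inverseˡ-unique _ _ (relation t)) ⟩
      x⁻¹ * - lincomb c B t                   ≈⟨ -‿distribʳ-* x⁻¹ _ ⟨
      - (x⁻¹ * lincomb c B t)                 ≈⟨ -‿distribˡ-* x⁻¹ _ ⟩
      - x⁻¹ * lincomb c B t                   ≈⟨ *-distribˡ-sumF (- x⁻¹) (λ j → c j * B j t) ⟩
      sumF (λ j → - x⁻¹ * (c j * B j t))      ≈⟨ sumF-cong (λ j → *-assoc (- x⁻¹) (c j) (B j t)) ⟨
      lincomb (λ j → - x⁻¹ * c j) B t         ∎

  -- The relation among unit r, v and B found by linDep-of-dim< cannot involve unit r,
  -- because a annihilates v and B but not unit r.
  kernel⊆span : ∀ {n} {B : Fin n → Vect (suc n)} {a : Vect (suc n)} {r} →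
                LinIndep B → ¬ a r ≈ 0# → (∀ j → dot a (B j) ≈ 0#) →
                ∀ {v} → dot a v ≈ 0# → v ∈Span B
  kernel⊆span {n} {B} {a} {r} B-indep aᵣ≉0 a⊥B {v} a·v≈0 = conclude (λ₁ ≟ 0#)
    where
    w : Fin (suc (suc n)) → Vect (suc n)
    w = unit r ∷ v ∷ B
    dependence : LinDep w
    dependence = linDep-of-dim< (ℕₚ.n<1+n (suc n)) w
    λs : Fin (suc (suc n)) → Carrier
    λs = proj₁ dependence
    λ₀ λ₁ : Carrier
    λ₀ = λs zero
    λ₁ = λs (suc zero)
    λ₂ : Fin n → Carrier
    λ₂ j = λs (suc (suc j))
    relation : lincomb λs w ≈ᵥ 0ᵥ
    relation = proj₁ (proj₂ dependence)

    λ₀≈0 : λ₀ ≈ 0#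
    λ₀≈0 = x*y≈0⇒x≈0 aᵣ≉0 (begin
      λ₀ * a r                                  ≈⟨ *-congˡ (dot-unitʳ a r) ⟨
      λ₀ * dot a (unit r)                       ≈⟨ +-identityʳ _ ⟨
      λ₀ * dot a (unit r) + 0#                  ≈⟨ +-congˡ rest≈0 ⟨
      dot λs (λ x → dot a (w x))                ≈⟨ dot-lincomb a λs w ⟨
      dot a (lincomb λs w)                      ≈⟨ dot-cong {a = a} (λ _ → refl) relation ⟩
      dot a 0ᵥ                                  ≈⟨ dot-zeroʳ a ⟩
      0#                                        ∎)
      where
      rest≈0 : λ₁ * dot a v + dot λ₂ (λ j → dot a (B j)) ≈ 0#
      rest≈0 = trans (+-cong (trans (*-congˡ {λ₁} a·v≈0) (zeroʳ λ₁))
                             (trans (dot-cong (λ _ → refl) a⊥B) (dot-zeroʳ λ₂)))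
                     (+-identityʳ 0#)

    relation′ : ∀ t → λ₁ * v t + lincomb λ₂ B t ≈ 0#
    relation′ t = trans (sym (x≈0⇒x*y+z≈z (unit r t) _ λ₀≈0)) (relation t)

    conclude : Dec (λ₁ ≈ 0#) → v ∈Span B
    conclude (no  λ₁≉0) = ∈Span-of-relation λ₁≉0 relation′
    conclude (yes λ₁≈0) = contradiction (all-zero (proj₁ (proj₂ (proj₂ dependence))))
                                        (proj₂ (proj₂ (proj₂ dependence)))
      where
      all-zero : ∀ i → λs i ≈ 0#
      all-zero zero          = λ₀≈0
      all-zero (suc zero)    = λ₁≈0
      all-zero (suc (suc j)) =
        B-indep λ₂ (λ t → trans (sym (x≈0⇒x*y+z≈z (v t) _ λ₁≈0)) (relation′ t)) j

  module KernelBasis {n} (a : Vect (suc n)) {r} (aᵣ≉0 : ¬ a r ≈ 0#) where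

    coeff : Fin n → Carrier
    coeff j = - (a (punchIn r j) * inv (a r) aᵣ≉0)

    basis : Fin n → Vect (suc n)
    basis j t = unit (punchIn r j) t + coeff j * unit r t

    dot-basis : ∀ a′ j → dot a′ (basis j) ≈ a′ (punchIn r j) + coeff j * a′ r
    dot-basis a′ j = trans (dot-+-scaleʳ a′ (unit (punchIn r j)) (unit r) (coeff j))
                           (+-cong (dot-unitʳ a′ (punchIn r j)) (*-congˡ (dot-unitʳ a′ r)))

    basis-⊥ : ∀ j → dot a (basis j) ≈ 0#
    basis-⊥ j = trans (dot-basis a j) (x-x*y⁻¹*y≈0 (a (punchIn r j)) aᵣ≉0)

    basis-punchIn : ∀ j t → basis j (punchIn r t) ≈ unit j t
    basis-punchIn j t = trans (+-cong (reflexive (unit-punchIn r j t)) pivot-entry≈0) (+-identityʳ (unit j t))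
      where
      pivot-entry≈0 : coeff j * unit r (punchIn r t) ≈ 0#
      pivot-entry≈0 =
        trans (*-congˡ (reflexive (unit-≢ (Fin.punchInᵢ≢i r t ∘ ≡.sym)))) (zeroʳ (coeff j))

    basis-independent : LinIndep basis
    basis-independent c c·basis≈0 j = begin
      c j                              ≈⟨ lincomb-unit c j ⟨
      lincomb c unit j                 ≈⟨ sumF-cong (λ i → *-congˡ (basis-punchIn i j)) ⟨
      lincomb c basis (punchIn r j)    ≈⟨ c·basis≈0 (punchIn r j) ⟩
      0#                               ∎

    proportional : ∀ a′ → (∀ j → dot a′ (basis j) ≈ 0#) →
                   a′ ≈ᵥ (λ t → (a′ r * inv (a r) aᵣ≉0) * a t)
    proportional a′ a′⊥basis = punchIn-elim (λ t → a′ t ≈ (a′ r * a⁻¹) * a t) r at-pivot at-punchIn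
      where
      a⁻¹ = inv (a r) aᵣ≉0
      at-pivot : a′ r ≈ a′ r * a⁻¹ * a r
      at-pivot = begin
        a′ r                  ≈⟨ *-identityʳ (a′ r) ⟨
        a′ r * 1#             ≈⟨ *-congˡ (inv-inverseˡ aᵣ≉0) ⟨
        a′ r * (a⁻¹ * a r)    ≈⟨ *-assoc (a′ r) a⁻¹ (a r) ⟨
        a′ r * a⁻¹ * a r      ∎
      at-punchIn : ∀ j → a′ (punchIn r j) ≈ a′ r * a⁻¹ * a (punchIn r j)
      at-punchIn j = begin
        a′ (punchIn r j)
          ≈⟨ +-inverseˡ-unique _ _ (trans (sym (dot-basis a′ j)) (a′⊥basis j)) ⟩
        - (- (a (punchIn r j) * a⁻¹) * a′ r)     ≈⟨ -‿cong (-‿distribˡ-* _ (a′ r)) ⟨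
        - - (a (punchIn r j) * a⁻¹ * a′ r)       ≈⟨ -‿involutive _ ⟩
        a (punchIn r j) * a⁻¹ * a′ r             ≈⟨ xy∙z≈zy∙x (a (punchIn r j)) a⁻¹ (a′ r) ⟩
        a′ r * a⁻¹ * a (punchIn r j)             ∎

  -- A dependency among the coordinate rows of B is a functional vanishing on every B j.
  normal-exists : ∀ {n} (B : Fin n → Vect (suc n)) →
                  ∃ λ a → (∀ j → dot a (B j) ≈ 0#) × ∃ λ r → ¬ a r ≈ 0#
  normal-exists B = linDep-of-dim< ℕₚ.≤-refl (λ r j → B j r)

  module Normal {n} (B : Basis (suc n) n) where

    normal : Vect (suc n)
    normal = proj₁ (normal-exists (proj₁ B))

    normal-⊥ : ∀ j → dot normal (proj₁ B j) ≈ 0#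
    normal-⊥ = proj₁ (proj₂ (normal-exists (proj₁ B)))

    pivot : Fin (suc n)
    pivot = proj₁ (proj₂ (proj₂ (normal-exists (proj₁ B))))

    pivot≉0 : ¬ normal pivot ≈ 0#
    pivot≉0 = proj₂ (proj₂ (proj₂ (normal-exists (proj₁ B))))

    span⇒kernel : ∀ {v} → v ∈Span proj₁ B → dot normal v ≈ 0#
    span⇒kernel = span⊆kernel {a = normal} normal-⊥

    kernel⇒span : ∀ {v} → dot normal v ≈ 0# → v ∈Span proj₁ B
    kernel⇒span = kernel⊆span {a = normal} (proj₂ B) pivot≉0 normal-⊥

  kernel⊆-of-proportional : ∀ {n} {a a′ : Vect n} {x x′} → ¬ x′ ≈ 0# →
                            (∀ t → x * a t ≈ x′ * a′ t) → ∀ {v} → dot a v ≈ 0# → dot a′ v ≈ 0#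
  kernel⊆-of-proportional {a = a} {a′} {x} {x′} x′≉0 xa≈x′a′ {v} a·v≈0 =
    x*y≈0⇒y≈0 x′≉0 (begin
    x′ * dot a′ v             ≈⟨ dot-scaleˡ x′ a′ v ⟨
    dot (λ t → x′ * a′ t) v   ≈⟨ dot-cong (λ t → sym (xa≈x′a′ t)) (λ _ → refl) ⟩
    dot (λ t → x * a t) v     ≈⟨ dot-scaleˡ x a v ⟩
    x * dot a v               ≈⟨ *-congˡ a·v≈0 ⟩
    x * 0#                    ≈⟨ zeroʳ x ⟩
    0#                        ∎)

  nonzero⇒pivot : ∀ {n} {a : Vect n} → ¬ a ≈ᵥ 0ᵥ → ∃ λ r → ¬ a r ≈ 0#
  nonzero⇒pivot {n} {a} = Fin.¬∀⟶∃¬ n _ (λ r → a r ≟ 0#)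

  -- Functionals avoiding a point set

  Avoids : ∀ {n L} → (Fin L → Vect n) → Vect n → Set ℓ₂
  Avoids p a = ∀ i → ¬ dot a (p i) ≈ 0#

  AvoidingFunctionals : ∀ {n L} → (Fin L → Vect n) → Setoid (ℓ₁ ⊔ ℓ₂) ℓ₂
  AvoidingFunctionals {n} p = SubSetoid (VectSetoid n) (λ a → ¬ a ≈ᵥ 0ᵥ × Avoids p a)

  Units : Setoid (ℓ₁ ⊔ ℓ₂) ℓ₂
  Units = SubSetoid setoid (λ x → ¬ x ≈ 0#)

  module _ {n L D} (p : Fin L → Vect (suc n)) (hyperplanes : HasCard D (DistGrass n p)) where
    private
      module H = Bijection hyperplanes
      module N (j : Fin D) = Normal (proj₁ (H.to j))

    -- A hyperplane determines its normal only up to a nonzero scalar, so the normals are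
    -- chosen along the enumeration of the hyperplanes, not as a function on their setoid.
    scaledNormal : Fin D × Setoid.Carrier Units → Setoid.Carrier (AvoidingFunctionals p)
    scaledNormal (j , x , x≉0) = (λ t → x * N.normal j t) , nonzero , avoids
      where
      nonzero : ¬ (λ t → x * N.normal j t) ≈ᵥ 0ᵥ
      nonzero xn≈0 = N.pivot≉0 j (x*y≈0⇒y≈0 x≉0 (xn≈0 (N.pivot j)))
      avoids : Avoids p (λ t → x * N.normal j t)
      avoids i xn·pᵢ≈0 = proj₂ (H.to j) i (N.kernel⇒span j (x*y≈0⇒y≈0 x≉0
                           (trans (sym (dot-scaleˡ x (N.normal j) (p i))) xn·pᵢ≈0)))

    private
      proportional⇒≡ : ∀ {j j′ x x′} → ¬ x ≈ 0# → ¬ x′ ≈ 0# →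
                       (∀ t → x * N.normal j t ≈ x′ * N.normal j′ t) → j ≡ j′
      proportional⇒≡ {j} {j′} x≉0 x′≉0 xn≈x′n′ = H.injective λ v →
        (λ v∈ → N.kernel⇒span j′
                  (kernel⊆-of-proportional x′≉0 xn≈x′n′ {v} (N.span⇒kernel j v∈))) ,
        (λ v∈ → N.kernel⇒span j
                  (kernel⊆-of-proportional x≉0 (λ t → sym (xn≈x′n′ t)) {v} (N.span⇒kernel j′ v∈)))

      scaledNormal-injective : Injective (Setoid._≈_ (≡.setoid (Fin D) ×ₛ Units))
                                         (Setoid._≈_ (AvoidingFunctionals p)) scaledNormal
      scaledNormal-injective {j , x , x≉0} {j′ , x′ , x′≉0} xn≈x′n′
        with proportional⇒≡ x≉0 x′≉0 xn≈x′n′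
      ... | ≡.refl = ≡.refl , *-cancelʳ (N.pivot≉0 j) (xn≈x′n′ (N.pivot j))

      -- The kernel of a is a distinguishing hyperplane, the j-th one say, and a vanishes on
      -- the kernel basis of the j-th normal, hence is a multiple of it.
      scaledNormal-surjective : StrictlySurjective (Setoid._≈_ (AvoidingFunctionals p)) scaledNormal
      scaledNormal-surjective (a , a≉0 , a-avoids) = (j , x , x≉0) , (λ t → sym (a≈xn t))
        where
        module K = KernelBasis a (proj₂ (nonzero⇒pivot a≉0))
        kernel : Setoid.Carrier (DistGrass n p)
        kernel = (K.basis , K.basis-independent) ,
                 λ i pᵢ∈ → a-avoids i (span⊆kernel {a = a} K.basis-⊥ pᵢ∈)
        j : Fin D
        j = proj₁ (H.strictlySurjective kernel)
        module Kⱼ = KernelBasis (N.normal j) (N.pivot≉0 j)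
        a⊥Kⱼ : ∀ i → dot a (Kⱼ.basis i) ≈ 0#
        a⊥Kⱼ i = span⊆kernel {a = a} K.basis-⊥
                   (proj₁ (j≈kernel (Kⱼ.basis i)) (N.kernel⇒span j (Kⱼ.basis-⊥ i)))
          where j≈kernel = proj₂ (H.strictlySurjective kernel)
        x : Carrier
        x = a (N.pivot j) * inv (N.normal j (N.pivot j)) (N.pivot≉0 j)
        a≈xn : a ≈ᵥ (λ t → x * N.normal j t)
        a≈xn = Kⱼ.proportional a a⊥Kⱼ
        x≉0 : ¬ x ≈ 0#
        x≉0 x≈0 = a≉0 (λ t → trans (a≈xn t) (trans (*-congʳ x≈0) (zeroˡ _)))

    scaledNormals-bijection : Bijection (≡.setoid (Fin D) ×ₛ Units) (AvoidingFunctionals p)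
    scaledNormals-bijection = mkBijection scaledNormal
      (λ { {j , _} (≡.refl , x≈x′) t → *-congʳ {N.normal j t} x≈x′ })
      (λ {u u′} → scaledNormal-injective {u} {u′}) scaledNormal-surjective

  SpansAll⇒index : ∀ {n L} {p : Fin L → Vect (suc n)} → SpansAll p → Fin L
  SpansAll⇒index {L = zero}  spans = contradiction (proj₂ (spans (unit zero)) zero) (0≉1 ∘ sym)
  SpansAll⇒index {L = suc _} _     = zero

  dot-injective : ∀ {n L} {p : Fin L → Vect n} → SpansAll p →
                  ∀ {a a′} → (∀ i → dot a (p i) ≈ dot a′ (p i)) → a ≈ᵥ a′
  dot-injective {p = p} spans {a} {a′} a·p≈a′·p t = begin
    a t                           ≈⟨ expand a ⟨
    dot c (λ i → dot a (p i))     ≈⟨ dot-cong (λ _ → refl) a·p≈a′·p ⟩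
    dot c (λ i → dot a′ (p i))    ≈⟨ expand a′ ⟩
    a′ t                          ∎
    where
    c = proj₁ (spans (unit t))
    unit≈c·p = proj₂ (spans (unit t))
    expand : ∀ b → dot c (λ i → dot b (p i)) ≈ b t
    expand b = begin
      dot c (λ i → dot b (p i))   ≈⟨ dot-lincomb b c p ⟨
      dot b (lincomb c p)         ≈⟨ dot-cong {a = b} (λ _ → refl) (λ s → sym (unit≈c·p s)) ⟩
      dot b (unit t)              ≈⟨ dot-unitʳ b t ⟩
      b t                         ∎

  codeWords-bijection : ∀ {n L} {p : Fin L → Vect (suc n)} → SpansAll p →
                        Bijection (CodeWords p L) (AvoidingFunctionals p)
  codeWords-bijection {n} {L} {p} spans = mkBijection functional
    (λ {u u′} → functional-cong {u} {u′}) (λ {u u′} → functional-injective {u} {u′})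
    functional-surjective
    where
    functional : Setoid.Carrier (CodeWords p L) → Setoid.Carrier (AvoidingFunctionals p)
    functional (w , (a , w≈a·p) , full) = a , nonzero , avoids
      where
      avoids : Avoids p a
      avoids i a·pᵢ≈0 = HasCard-full full i (trans (w≈a·p i) a·pᵢ≈0)
      nonzero : ¬ a ≈ᵥ 0ᵥ
      nonzero a≈0 = avoids i₀ (trans (dot-cong {v = p i₀} a≈0 (λ _ → refl)) (dot-zeroˡ (p i₀)))
        where i₀ = SpansAll⇒index spans
    functional-cong : Congruent (Setoid._≈_ (CodeWords p L)) (Setoid._≈_ (AvoidingFunctionals p)) functional
    functional-cong {w , (a , w≈a·p) , _} {w′ , (a′ , w′≈a′·p) , _} w≈w′ =
      dot-injective spans (λ i → trans (sym (w≈a·p i)) (trans (w≈w′ i) (w′≈a′·p i)))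
    functional-injective : Injective (Setoid._≈_ (CodeWords p L)) (Setoid._≈_ (AvoidingFunctionals p)) functional
    functional-injective {w , (a , w≈a·p) , _} {w′ , (a′ , w′≈a′·p) , _} a≈a′ i =
      trans (w≈a·p i) (trans (dot-cong {v = p i} a≈a′ (λ _ → refl)) (sym (w′≈a′·p i)))
    functional-surjective : StrictlySurjective (Setoid._≈_ (AvoidingFunctionals p)) functional
    functional-surjective (a , _ , avoids) =
      ((λ i → dot a (p i)) , (a , λ _ → refl) , HasCard-all avoids) , λ _ → refl

  noPoints : ∀ {n} → Fin 0 → Vect n
  noPoints ()

  grass-bijection : ∀ {n k} → Bijection (Grass n k) (DistGrass k (noPoints {n}))
  grass-bijection = mkBijection (λ B → B , λ ()) (λ B≈B′ → B≈B′) (λ B≈B′ → B≈B′)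
                                (λ (B , _) → B , λ v → (λ v∈ → v∈) , (λ v∈ → v∈))

  avoiding-noPoints-bijection : ∀ {n} → Bijection (SubSetoid (VectSetoid n) (λ a → ¬ a ≈ᵥ 0ᵥ))
                                                  (AvoidingFunctionals (noPoints {n}))
  avoiding-noPoints-bijection = mkBijection (λ (a , a≉0) → a , a≉0 , λ ()) (λ a≈a′ → a≈a′)
                                            (λ a≈a′ → a≈a′) (λ (a , a≉0 , _) → (a , a≉0) , λ _ → refl)

  cons-bijection : ∀ {n} → Bijection (setoid ×ₛ VectSetoid n) (VectSetoid (suc n))
  cons-bijection = mkBijection (λ (x , v) → x ∷ v)
    (λ { (x≈x′ , v≈v′) zero → x≈x′ ; (x≈x′ , v≈v′) (suc t) → v≈v′ t })
    (λ x∷v≈x′∷v′ → x∷v≈x′∷v′ zero , x∷v≈x′∷v′ ∘ suc)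
    (λ v → (v zero , tail v) , λ { zero → refl ; (suc t) → refl })

  HasCard-Vect : ∀ {q} → HasCard q setoid → ∀ n → HasCard (q ^ n) (VectSetoid n)
  HasCard-Vect cardF zero    =
    mkBijection (λ _ ()) (λ _ ()) (λ { {zero} {zero} _ → ≡.refl }) (λ _ → zero , λ ())
  HasCard-Vect cardF (suc n) = Comp.bijection (HasCard-× cardF (HasCard-Vect cardF n)) cons-bijection

  HasCard-avoiding : ∀ {q n L D} → HasCard q setoid → (p : Fin L → Vect (suc n)) →
                     HasCard D (DistGrass n p) → HasCard (D ℕ.* (q ℕ.∸ 1)) (AvoidingFunctionals p)
  HasCard-avoiding cardF p hyperplanes =
    Comp.bijection (HasCard-× (Id.bijection _) (HasCard-remove cardF 0#))
                   (scaledNormals-bijection p hyperplanes)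

  HasCard-avoiding-noPoints : ∀ {q} → HasCard q setoid → ∀ n →
                              HasCard (q ^ n ℕ.∸ 1) (AvoidingFunctionals (noPoints {n}))
  HasCard-avoiding-noPoints cardF n =
    Comp.bijection (HasCard-remove (HasCard-Vect cardF n) 0ᵥ) avoiding-noPoints-bijection

open import Data.Nat using (_*_; _∸_)

proposition5p10 : ∀ {c ℓ : Level} (𝔽 : Field c ℓ) (q : ℕ)
    → HasCard q (Field.setoid 𝔽)
    → (N : ℕ) → 3 ≤ N
    → (L : ℕ) (p : Fin L → FieldDefs.Vect 𝔽 N)
    → FieldDefs.IsPointFamily 𝔽 p
    → FieldDefs.SpansAll 𝔽 p
    → (D H W : ℕ)
    → HasCard D (FieldDefs.DistGrass 𝔽 (N ∸ 1) p)
    → HasCard H (FieldDefs.Grass 𝔽 N (N ∸ 1))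
    → HasCard W (FieldDefs.CodeWords 𝔽 p L)
    → D * (q ^ N ∸ 1) ≡ W * H
proposition5p10 𝔽 q cardF (suc n) _ L p _ spans D H W cardD cardH cardW = begin
  D * (q ^ suc n ∸ 1)    ≡⟨ ≡.cong (D *_) nonzeroFunctionals ⟩
  D * (H * (q ∸ 1))      ≡⟨ ≡.cong (D *_) (ℕₚ.*-comm H (q ∸ 1)) ⟩
  D * ((q ∸ 1) * H)      ≡⟨ ℕₚ.*-assoc D (q ∸ 1) H ⟨
  D * (q ∸ 1) * H        ≡⟨ ≡.cong (_* H) fullWeightWords ⟨
  W * H                  ∎
  where
  open ≡.≡-Reasoning
  open LinearAlgebra 𝔽 (HasCard⇒decidable cardF)
  fullWeightWords : W ≡ D * (q ∸ 1)
  fullWeightWords = HasCard-unique (Comp.bijection cardW (codeWords-bijection spans))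
                                   (HasCard-avoiding cardF p cardD)
  nonzeroFunctionals : q ^ suc n ∸ 1 ≡ H * (q ∸ 1)
  nonzeroFunctionals = HasCard-unique (HasCard-avoiding-noPoints cardF (suc n))
                                      (HasCard-avoiding cardF noPoints (Comp.bijection cardH grass-bijection))
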